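{- Let $\ell\geq 2$ be an integer and let $G$ be a graph with girth exactly $2\ell$ and no even hole of length at least $2\ell+2$. Let $H$ be an induced subgraph of $G$ which is a theta graph. (1) If all cycles of $H$ are even, then either all three ears of $H$ have length $\ell$, or exactly one ear of $H$ has length one. (2) If some cycle of $H$ is odd, let $Q$ be the ear of $H$ shared by the two odd cycles of $H$ and let $P,P'$ be the other two ears. Then $|Q|=1$ or $|Q|>\max\{\ell,|P|,|P'|\}$.
   Context: A hole is an induced cycle of length at least four; even/odd refers to the parity of its length. A theta graph consists of two distinct vertices joined by three internally disjoint paths; these three paths are the ears of $H$ (an ear of a graph is a path whose internal vertices have degree $2$ in the graph and whose ends have degree at least $3$). A theta graph has exactly three cycles, each the union of two ears. The length $|P|$ of a path is its number of edges. -}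

module Defs where

open import Data.Nat using (ℕ; zero; suc; _+_; _*_; _≤_; _<_; _⊔_)
open import Data.Nat.Divisibility using (_∣_)
open import Data.Fin using (Fin; toℕ; fromℕ; inject₁) renaming (zero to fzero; suc to fsuc)
open import Data.Product using (Σ; ∃; ∃-syntax; _×_; _,_)
open import Data.Sum using (_⊎_)
open import Relation.Nullary using (¬_)
open import Relation.Binary.PropositionalEquality using (_≡_; _≢_)
open import Relation.Binary.Definitions using (Decidable)
open import Function.Definitions using (Injective)

record Graph (n : ℕ) : Set₁ where
  field
    Adj        : Fin n → Fin n → Set
    adj-sym    : ∀ {u v} → Adj u v → Adj v u
    adj-irrefl : ∀ {u} → ¬ Adj u u
    adj-dec    : Decidable Adj
open Graph public

Even : ℕ → Set
Even k = 2 ∣ k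

Odd : ℕ → Set
Odd k = ¬ (2 ∣ k)

CycConsec : (k : ℕ) → Fin k → Fin k → Set
CycConsec k i j =
  suc (toℕ i) ≡ toℕ j ⊎ suc (toℕ j) ≡ toℕ i
  ⊎ (toℕ i ≡ 0 × suc (toℕ j) ≡ k) ⊎ (toℕ j ≡ 0 × suc (toℕ i) ≡ k)

IsCycle : ∀ {n} → Graph n → (k : ℕ) → (Fin k → Fin n) → Set
IsCycle G k c =
  3 ≤ k × Injective _≡_ _≡_ c × (∀ i j → CycConsec k i j → Adj G (c i) (c j))

IsInducedCycle : ∀ {n} → Graph n → (k : ℕ) → (Fin k → Fin n) → Set
IsInducedCycle G k c =
  IsCycle G k c × (∀ i j → Adj G (c i) (c j) → CycConsec k i j)

IsHole : ∀ {n} → Graph n → (k : ℕ) → (Fin k → Fin n) → Set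
IsHole G k c = IsInducedCycle G k c × 4 ≤ k

HasGirth : ∀ {n} → Graph n → ℕ → Set
HasGirth G g =
  (Σ (Fin g → _) λ c → IsCycle G g c) × (∀ k c → IsCycle G k c → g ≤ k)

NoEvenHoleAtLeast : ∀ {n} → Graph n → ℕ → Set
NoEvenHoleAtLeast G m = ∀ k c → IsHole G k c → Even k → ¬ (m ≤ k)

IsPath : ∀ {n} → Graph n → (k : ℕ) → (Fin (suc k) → Fin n) → Fin n → Fin n → Set
IsPath G k p a b =
  Injective _≡_ _≡_ p × p fzero ≡ a × p (fromℕ k) ≡ b
  × (∀ (i : Fin k) → Adj G (p (inject₁ i)) (p (fsuc i)))

-- An induced subgraph H of G which is a theta graph, given by its two
-- branch vertices a ≠ b and its three ears path 0, path 1, path 2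
-- (ear r has length len r).  H is the subgraph of G induced on the union
-- of the vertex sets of the three ears.
record Theta {n : ℕ} (G : Graph n) : Set where
  field
    a b     : Fin n
    a≢b     : a ≢ b
    len     : Fin 3 → ℕ
    path    : (r : Fin 3) → Fin (suc (len r)) → Fin n
    isPath  : ∀ r → IsPath G (len r) (path r) a b
    intDisj : ∀ r s → r ≢ s → ∀ x y → path r x ≡ path s y →
              path r x ≡ a ⊎ path r x ≡ b
    -- the three paths are distinct (in a simple graph, with internal
    -- disjointness, this only excludes two of them being the edge ab)
    distinct : ∀ r s → r ≢ s → ¬ (len r ≡ 1 × len s ≡ 1)
    induced : ∀ r s x y → Adj G (path r x) (path s y) →
              ∃[ t ] ∃[ i ] ((path t (inject₁ i) ≡ path r x × path t (fsuc i) ≡ path s y)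
                           ⊎ (path t (inject₁ i) ≡ path s y × path t (fsuc i) ≡ path r x))

module Submission where

-- The union of two ears of H is a cycle of G whose length is the sum of their
-- lengths, so by the girth assumption every two ears have total length at least
-- 2ℓ.  Unless the third ear is the single edge ab, this cycle is moreover
-- induced, hence a hole; if its length is even it is below 2ℓ + 2, and it is not
-- the odd number 2ℓ + 1, so it is exactly 2ℓ.
-- (1) If no ear is an edge, all three pairwise sums are 2ℓ, so every ear has
-- length ℓ; and two ears cannot both be edges.
-- (2) The two odd cycles through Q are longer than 2ℓ, while the even cycle
-- P ∪ P′ has length exactly 2ℓ unless |Q| = 1.  Hence |Q| + |P| > |P| + |P′|
-- and |Q| + |P′| > |P| + |P′|, and if |Q| ≤ ℓ both |P| and |P′| would exceed ℓ.

open import Defs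
open import Data.Nat using (ℕ; zero; suc; _+_; _*_; _∸_; _≤_; _<_; _⊔_; z≤n; s≤s; z<s; _≤?_; _≟_)
open import Data.Nat.Properties
open import Data.Nat.Divisibility using (∣-refl; _∣0; ∣1⇒≡1; ∣m∣n⇒∣m+n; ∣m+n∣m⇒∣n; m∣m*n)
open import Data.Nat.Solver using (module +-*-Solver)
open import Data.Fin using (Fin; toℕ; fromℕ; fromℕ<; inject₁) renaming (zero to fzero; suc to fsuc)
open import Data.Fin.Properties using (toℕ-injective; toℕ-fromℕ; toℕ-fromℕ<; toℕ-inject₁; toℕ<n; punchOut-injective; any?) renaming (_≟_ to _≟ᶠ_)
open import Data.Product using (∃₂; ∃-syntax; _×_; _,_; proj₁; proj₂)
open import Data.Sum using (_⊎_; inj₁; inj₂; [_,_]′; swap; fromInj₂)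
open import Data.Empty using (⊥-elim)
open import Function using (_∘_)
open import Relation.Nullary using (¬_; Dec; yes; no; contradiction)
open import Relation.Binary.PropositionalEquality

private
  variable
    k m n o ℓ x y : ℕ

even⊎even-suc : ∀ m → Even m ⊎ Even (suc m)
even⊎even-suc zero = inj₁ (2 ∣0)
even⊎even-suc (suc m) = [ inj₂ ∘ ∣m∣n⇒∣m+n ∣-refl , inj₁ ]′ (even⊎even-suc m)

even⇒odd-suc : Even m → Odd (suc m)
even⇒odd-suc {m} m-even 1+m-even =
  contradiction (∣1⇒≡1 (∣m+n∣m⇒∣n (subst Even (+-comm 1 m) 1+m-even) m-even)) λ ()

odd⇒even-suc : Odd m → Even (suc m)
odd⇒even-suc {m} m-odd = fromInj₂ (λ m-even → contradiction m-even m-odd) (even⊎even-suc m)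

odd+odd⇒even : Odd m → Odd n → Even (m + n)
odd+odd⇒even {m} {n} m-odd n-odd = ∣m+n∣m⇒∣n (subst Even 1+m+1+n≡2+m+n sum-even) (∣-refl {2})
  where
  sum-even : Even (suc m + suc n)
  sum-even = ∣m∣n⇒∣m+n (odd⇒even-suc m-odd) (odd⇒even-suc n-odd)
  1+m+1+n≡2+m+n : suc m + suc n ≡ 2 + (m + n)
  1+m+1+n≡2+m+n = cong suc (+-suc m n)

odd-sums⇒even : Odd (m + n) → Odd (m + o) → Even (n + o)
odd-sums⇒even {m} {n} {o} odd₁ odd₂ =
  ∣m+n∣m⇒∣n (subst Even (rearrange m n o) (odd+odd⇒even odd₁ odd₂)) (m∣m*n m)
  where
  open +-*-Solver
  rearrange : ∀ m n o → (m + n) + (m + o) ≡ 2 * m + (n + o)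
  rearrange = solve 3 (λ m n o → (m :+ n) :+ (m :+ o) := con 2 :* m :+ (n :+ o)) refl

even<even⇒+2≤ : Even m → Even n → m < n → m + 2 ≤ n
even<even⇒+2≤ {m} {n} m-even n-even m<n with m≤n⇒m<n∨m≡n m<n
... | inj₁ 1+m<n = subst (_≤ n) (+-comm 2 m) 1+m<n
... | inj₂ refl = contradiction n-even (even⇒odd-suc m-even)

even≤odd⇒< : Even m → Odd n → m ≤ n → m < n
even≤odd⇒< m-even n-odd m≤n with m≤n⇒m<n∨m≡n m≤n
... | inj₁ m<n = m<n
... | inj₂ refl = contradiction m-even n-odd

2*n≡n+n : ∀ n → 2 * n ≡ n + n
2*n≡n+n n = cong (n +_) (+-identityʳ n)

m+m≡2*n⇒m≡n : m + m ≡ 2 * n → m ≡ n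
m+m≡2*n⇒m≡n {m} {n} eq = *-cancelˡ-≡ m n 2 (trans (2*n≡n+n m) eq)

equal-pairwise-sums : m + n ≡ 2 * ℓ → m + o ≡ 2 * ℓ → n + o ≡ 2 * ℓ →
                      m ≡ ℓ × n ≡ ℓ × o ≡ ℓ
equal-pairwise-sums {m} {n} {ℓ} {o} m+n m+o n+o = m≡ℓ , n≡ℓ , o≡ℓ
  where
  n≡o : n ≡ o
  n≡o = +-cancelˡ-≡ m n o (trans m+n (sym m+o))
  m≡n : m ≡ n
  m≡n = +-cancelʳ-≡ o m n (trans m+o (sym n+o))
  n≡ℓ : n ≡ ℓ
  n≡ℓ = m+m≡2*n⇒m≡n (trans (cong (n +_) n≡o) n+o)
  m≡ℓ : m ≡ ℓ
  m≡ℓ = trans m≡n n≡ℓ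
  o≡ℓ : o ≡ ℓ
  o≡ℓ = trans (sym n≡o) n≡ℓ

ℓ⊔m⊔n<o : m + n ≡ 2 * ℓ → 2 * ℓ < o + m → 2 * ℓ < o + n → ℓ ⊔ m ⊔ n < o
ℓ⊔m⊔n<o {m} {n} {ℓ} {o} m+n 2ℓ<o+m 2ℓ<o+n = ⊔-lub (⊔-lub ℓ<o m<o) n<o
  where
  m<o : m < o
  m<o = +-cancelʳ-< n m o (subst (_< o + n) (sym m+n) 2ℓ<o+n)
  n<o : n < o
  n<o = +-cancelˡ-< m n o (subst₂ _<_ (sym m+n) (+-comm o m) 2ℓ<o+m)
  ℓ< : ∀ {w} → o ≤ ℓ → 2 * ℓ < o + w → ℓ < w
  ℓ< {w} o≤ℓ 2ℓ<o+w =
    +-cancelˡ-< ℓ ℓ w (<-≤-trans (subst (_< o + w) (2*n≡n+n ℓ) 2ℓ<o+w) (+-monoˡ-≤ w o≤ℓ))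
  ℓ<o : ℓ < o
  ℓ<o = ≰⇒> λ o≤ℓ →
    <-irrefl (sym (trans m+n (2*n≡n+n ℓ))) (+-mono-< (ℓ< o≤ℓ 2ℓ<o+m) (ℓ< o≤ℓ 2ℓ<o+n))

3≤m+n : 0 < m → 0 < n → ¬ (m ≡ 1 × n ≡ 1) → 3 ≤ m + n
3≤m+n {suc zero} {suc zero} _ _ not-both-1 = contradiction (refl , refl) not-both-1
3≤m+n {suc zero} {suc (suc n)} _ _ _ = s≤s (s≤s (s≤s z≤n))
3≤m+n {suc (suc m)} {suc n} _ _ _ = s≤s (s≤s (subst (1 ≤_) (sym (+-suc m n)) (s≤s z≤n)))

m∸n≡1+[m∸1+n] : n < m → m ∸ n ≡ suc (m ∸ suc n)
m∸n≡1+[m∸1+n] (s≤s n≤m) = +-∸-assoc 1 n≤m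

ends-consecutive⇒≡1 : k < m → k ≡ 0 ⊎ k ≡ m → suc k ≡ 0 ⊎ suc k ≡ m → m ≡ 1
ends-consecutive⇒≡1 _ (inj₁ refl) (inj₂ 1≡m) = sym 1≡m
ends-consecutive⇒≡1 k<m (inj₂ refl) _ = contradiction k<m (<-irrefl refl)
ends-consecutive⇒≡1 _ _ (inj₁ ())

Fin2-≢⇒≡ : ∀ {x y z : Fin 2} → x ≢ z → y ≢ z → x ≡ y
Fin2-≢⇒≡ {fzero} {fzero} _ _ = refl
Fin2-≢⇒≡ {fsuc fzero} {fsuc fzero} _ _ = refl
Fin2-≢⇒≡ {fzero} {fsuc fzero} {fzero} x≢z _ = contradiction refl x≢z
Fin2-≢⇒≡ {fzero} {fsuc fzero} {fsuc fzero} _ y≢z = contradiction refl y≢z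
Fin2-≢⇒≡ {fsuc fzero} {fzero} {fzero} _ y≢z = contradiction refl y≢z
Fin2-≢⇒≡ {fsuc fzero} {fzero} {fsuc fzero} x≢z _ = contradiction refl x≢z

-- Punching out p leaves u, q and p′ in Fin 2, where u and q both differ from p′.
Fin3-third : ∀ {p p′ q u : Fin 3} → p ≢ p′ → p ≢ q → p′ ≢ q → u ≢ p → u ≢ p′ → u ≡ q
Fin3-third p≢p′ p≢q p′≢q u≢p u≢p′ =
  punchOut-injective (u≢p ∘ sym) p≢q
    (Fin2-≢⇒≡ (u≢p′ ∘ punchOut-injective _ p≢p′) (p′≢q ∘ sym ∘ punchOut-injective _ p≢p′))

clamp : ∀ m → ℕ → Fin (suc m)
clamp zero _ = fzero
clamp (suc m) zero = fzero
clamp (suc m) (suc k) = fsuc (clamp m k)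

toℕ-clamp : k ≤ m → toℕ (clamp m k) ≡ k
toℕ-clamp {zero} {zero} _ = refl
toℕ-clamp {zero} {suc m} _ = refl
toℕ-clamp {suc k} {suc m} (s≤s k≤m) = cong suc (toℕ-clamp k≤m)

clamp-toℕ : (i : Fin (suc m)) → clamp m (toℕ i) ≡ i
clamp-toℕ i = toℕ-injective (toℕ-clamp (<⇒≤pred (toℕ<n i)))

CycSucc : (k : ℕ) → Fin k → Fin k → Set
CycSucc k i j = suc (toℕ i) ≡ toℕ j ⊎ (toℕ j ≡ 0 × suc (toℕ i) ≡ k)

module _ {k : ℕ} {i j : Fin k} where

  CycSucc⊎⇒CycConsec : CycSucc k i j ⊎ CycSucc k j i → CycConsec k i j
  CycSucc⊎⇒CycConsec (inj₁ (inj₁ e)) = inj₁ e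
  CycSucc⊎⇒CycConsec (inj₂ (inj₁ e)) = inj₂ (inj₁ e)
  CycSucc⊎⇒CycConsec (inj₂ (inj₂ e)) = inj₂ (inj₂ (inj₁ e))
  CycSucc⊎⇒CycConsec (inj₁ (inj₂ e)) = inj₂ (inj₂ (inj₂ e))

  CycConsec⇒CycSucc⊎ : CycConsec k i j → CycSucc k i j ⊎ CycSucc k j i
  CycConsec⇒CycSucc⊎ (inj₁ e) = inj₁ (inj₁ e)
  CycConsec⇒CycSucc⊎ (inj₂ (inj₁ e)) = inj₂ (inj₁ e)
  CycConsec⇒CycSucc⊎ (inj₂ (inj₂ (inj₁ e))) = inj₂ (inj₂ e)
  CycConsec⇒CycSucc⊎ (inj₂ (inj₂ (inj₂ e))) = inj₁ (inj₂ e)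

module ClosedWalk {n} (G : Graph n) {L : ℕ} (walk : ℕ → Fin n)
  (walk-injective : ∀ {x y} → x < L → y < L → walk x ≡ walk y → x ≡ y)
  (walk-closed : walk L ≡ walk 0)
  (walk-adjacent : ∀ {k} → k < L → Adj G (walk k) (walk (suc k)))
  where

  cycle : Fin L → Fin n
  cycle i = walk (toℕ i)

  CycSucc⇒Adj : ∀ {i j} → CycSucc L i j → Adj G (cycle i) (cycle j)
  CycSucc⇒Adj {i} (inj₁ 1+i≡j) =
    subst (λ k → Adj G (cycle i) (walk k)) 1+i≡j (walk-adjacent (toℕ<n i))
  CycSucc⇒Adj {i} {j} (inj₂ (j≡0 , 1+i≡L)) = subst (Adj G (cycle i)) wrap (walk-adjacent (toℕ<n i))
    where
    open ≡-Reasoning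
    wrap : walk (suc (toℕ i)) ≡ cycle j
    wrap = begin
      walk (suc (toℕ i)) ≡⟨ cong walk 1+i≡L ⟩
      walk L             ≡⟨ walk-closed ⟩
      walk 0             ≡⟨ cong walk (sym j≡0) ⟩
      cycle j            ∎

  cycle-isCycle : 3 ≤ L → IsCycle G L cycle
  cycle-isCycle 3≤L =
    3≤L ,
    (λ {i} {j} eq → toℕ-injective (walk-injective (toℕ<n i) (toℕ<n j) eq)) ,
    (λ i j → [ CycSucc⇒Adj , adj-sym G ∘ CycSucc⇒Adj ]′ ∘ CycConsec⇒CycSucc⊎)

  walk-step⇒CycSucc : ∀ {x i j} → x < L → walk x ≡ cycle i → walk (suc x) ≡ cycle j →
                      CycSucc L i j
  walk-step⇒CycSucc {x} {i} {j} x<L eᵢ eⱼ = [ inner , wrap ]′ (m≤n⇒m<n∨m≡n x<L)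
    where
    x≡i : x ≡ toℕ i
    x≡i = walk-injective x<L (toℕ<n i) eᵢ
    inner : suc x < L → CycSucc L i j
    inner 1+x<L = inj₁ (trans (cong suc (sym x≡i)) (walk-injective 1+x<L (toℕ<n j) eⱼ))
    wrap : suc x ≡ L → CycSucc L i j
    wrap 1+x≡L = inj₂ (sym 0≡j , trans (cong suc (sym x≡i)) 1+x≡L)
      where
      0≡j : 0 ≡ toℕ j
      0≡j = walk-injective (≤-<-trans z≤n x<L) (toℕ<n j)
              (trans (sym walk-closed) (trans (cong walk (sym 1+x≡L)) eⱼ))

-- Vertex k of ear u, counted from a; indices beyond len u are clamped to b.
module Ears {n} {G : Graph n} (H : Theta G) where
  open Theta H

  ear : Fin 3 → ℕ → Fin n
  ear u k = path u (clamp (len u) k)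

  ear-toℕ : ∀ u (i : Fin (suc (len u))) → ear u (toℕ i) ≡ path u i
  ear-toℕ u i = cong (path u) (clamp-toℕ i)

  ear-inject₁ : ∀ u (i : Fin (len u)) → ear u (toℕ i) ≡ path u (inject₁ i)
  ear-inject₁ u i = trans (cong (ear u) (sym (toℕ-inject₁ i))) (ear-toℕ u (inject₁ i))

  ear-start : ∀ u → ear u 0 ≡ a
  ear-start u = trans (ear-toℕ u fzero) (proj₁ (proj₂ (isPath u)))

  ear-end : ∀ u → ear u (len u) ≡ b
  ear-end u = trans (cong (ear u) (sym (toℕ-fromℕ (len u))))
                    (trans (ear-toℕ u (fromℕ (len u))) (proj₁ (proj₂ (proj₂ (isPath u)))))

  ear-injective : ∀ u {x y} → x ≤ len u → y ≤ len u → ear u x ≡ ear u y → x ≡ y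
  ear-injective u x≤ y≤ eq =
    trans (sym (toℕ-clamp x≤)) (trans (cong toℕ (proj₁ (isPath u) eq)) (toℕ-clamp y≤))

  ear-adjacent : ∀ u {k} → k < len u → Adj G (ear u k) (ear u (suc k))
  ear-adjacent u k<len = subst (λ j → Adj G (ear u j) (ear u (suc j))) (toℕ-fromℕ< k<len)
    (subst₂ (Adj G) (sym (ear-inject₁ u i)) (sym (ear-toℕ u (fsuc i)))
      (proj₂ (proj₂ (proj₂ (isPath u))) i))
    where
    i : Fin (len u)
    i = fromℕ< k<len

  ear-ends : ∀ u {k} → k ≤ len u → ear u k ≡ a ⊎ ear u k ≡ b → k ≡ 0 ⊎ k ≡ len u
  ear-ends u k≤ (inj₁ ≡a) = inj₁ (ear-injective u k≤ z≤n (trans ≡a (sym (ear-start u))))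
  ear-ends u k≤ (inj₂ ≡b) = inj₂ (ear-injective u k≤ ≤-refl (trans ≡b (sym (ear-end u))))

  len-positive : ∀ u → 0 < len u
  len-positive u = n≢0⇒n>0 λ len≡0 →
    a≢b (trans (sym (ear-start u)) (trans (cong (ear u) (sym len≡0)) (ear-end u)))

module TwoEarCycle {n} {G : Graph n} (H : Theta G) {r s : Fin 3} (r≢s : r ≢ s) where
  open Theta H
  open Ears H

  L : ℕ
  L = len r + len s

  walk : ℕ → Fin n
  walk k with k ≤? len r
  ... | yes _ = ear r k
  ... | no _ = ear s (L ∸ k)

  walk-r : k ≤ len r → walk k ≡ ear r k
  walk-r {k} k≤ with k ≤? len r
  ... | yes _ = refl
  ... | no k≰ = contradiction k≤ k≰

  walk-s : len r ≤ k → walk k ≡ ear s (L ∸ k)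
  walk-s {k} r≤k with k ≤? len r
  ... | no _ = refl
  ... | yes k≤r with ≤-antisym k≤r r≤k
  ...   | refl = trans (ear-end r) (sym (trans (cong (ear s) (m+n∸m≡n (len r) (len s))) (ear-end s)))

  L∸k<len-s : len r < k → k ≤ L → L ∸ k < len s
  L∸k<len-s {k} r<k k≤L = subst (L ∸ k <_) (m+n∸m≡n (len r) (len s)) (∸-monoʳ-< r<k k≤L)

  L∸k≤len-s : len r ≤ k → L ∸ k ≤ len s
  L∸k≤len-s {k} r≤k = subst (L ∸ k ≤_) (m+n∸m≡n (len r) (len s)) (∸-monoʳ-≤ L r≤k)

  ear-s≡walk : y ≤ len s → ear s y ≡ walk (L ∸ y)
  ear-s≡walk {y} y≤ =
    sym (trans (walk-s r≤L∸y) (cong (ear s) (m∸[m∸n]≡n (≤-trans y≤ (m≤n+m (len s) (len r))))))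
    where
    r≤L∸y : len r ≤ L ∸ y
    r≤L∸y = subst (_≤ L ∸ y) (m+n∸n≡m (len r) (len s)) (∸-monoʳ-≤ L y≤)

  walk-closed : walk L ≡ walk 0
  walk-closed = begin
    walk L         ≡⟨ walk-s (m≤m+n (len r) (len s)) ⟩
    ear s (L ∸ L)  ≡⟨ cong (ear s) (n∸n≡0 L) ⟩
    ear s 0        ≡⟨ ear-start s ⟩
    a              ≡⟨ ear-start r ⟨
    ear r 0        ≡⟨ walk-r z≤n ⟨
    walk 0         ∎
    where open ≡-Reasoning

  walk-r≢walk-s : x ≤ len r → len r < y → y < L → walk x ≢ walk y
  walk-r≢walk-s {x} {y} x≤ r<y y<L eq =
    [ <⇒≢ (m<n⇒0<n∸m y<L) ∘ sym , <⇒≢ (L∸k<len-s r<y (<⇒≤ y<L)) ]′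
      (ear-ends s (L∸k≤len-s (<⇒≤ r<y)) (intDisj s r (r≢s ∘ sym) _ _ (sym ear-r≡ear-s)))
    where
    ear-r≡ear-s : ear r x ≡ ear s (L ∸ y)
    ear-r≡ear-s = trans (sym (walk-r x≤)) (trans eq (walk-s (<⇒≤ r<y)))

  walk-injective : x < L → y < L → walk x ≡ walk y → x ≡ y
  walk-injective {x} {y} x<L y<L eq = by-side (x ≤? len r) (y ≤? len r)
    where
    by-side : Dec (x ≤ len r) → Dec (y ≤ len r) → x ≡ y
    by-side (yes x≤) (yes y≤) = ear-injective r x≤ y≤ (trans (sym (walk-r x≤)) (trans eq (walk-r y≤)))
    by-side (yes x≤) (no y≰) = contradiction eq (walk-r≢walk-s x≤ (≰⇒> y≰) y<L)
    by-side (no x≰) (yes y≤) = contradiction (sym eq) (walk-r≢walk-s y≤ (≰⇒> x≰) x<L)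
    by-side (no x≰) (no y≰) = ∸-cancelˡ-≡ (<⇒≤ x<L) (<⇒≤ y<L)
      (ear-injective s (L∸k≤len-s r≤x) (L∸k≤len-s r≤y)
        (trans (sym (walk-s r≤x)) (trans eq (walk-s r≤y))))
      where
      r≤x : len r ≤ x
      r≤x = <⇒≤ (≰⇒> x≰)
      r≤y : len r ≤ y
      r≤y = <⇒≤ (≰⇒> y≰)

  walk-adjacent : k < L → Adj G (walk k) (walk (suc k))
  walk-adjacent {k} k<L = by-side (suc k ≤? len r)
    where
    by-side : Dec (suc k ≤ len r) → Adj G (walk k) (walk (suc k))
    by-side (yes 1+k≤) =
      subst₂ (Adj G) (sym (walk-r (<⇒≤ 1+k≤))) (sym (walk-r 1+k≤)) (ear-adjacent r 1+k≤)
    by-side (no 1+k≰) = adj-sym G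
      (subst₂ (Adj G) (sym (walk-s (<⇒≤ r<1+k))) walk-k (ear-adjacent s (L∸k<len-s r<1+k k<L)))
      where
      r<1+k : len r < suc k
      r<1+k = ≰⇒> 1+k≰
      walk-k : ear s (suc (L ∸ suc k)) ≡ walk k
      walk-k = sym (trans (walk-s (≤-pred r<1+k)) (cong (ear s) (m∸n≡1+[m∸1+n] k<L)))

  walk-on-ears : ∀ k → ∃₂ λ u z → (u ≡ r ⊎ u ≡ s) × walk k ≡ path u z
  walk-on-ears k = by-side (k ≤? len r)
    where
    by-side : Dec (k ≤ len r) → ∃₂ λ u z → (u ≡ r ⊎ u ≡ s) × walk k ≡ path u z
    by-side (yes k≤) = r , clamp (len r) k , inj₁ refl , walk-r k≤
    by-side (no k≰) = s , clamp (len s) (L ∸ k) , inj₂ refl , walk-s (<⇒≤ (≰⇒> k≰))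

  open ClosedWalk G walk walk-injective walk-closed walk-adjacent public

  isCycle : IsCycle G L cycle
  isCycle = cycle-isCycle (3≤m+n (len-positive r) (len-positive s) (distinct r s r≢s))

  other-ear-meets-cycle-at-ends : ∀ {t i} → t ≢ r → t ≢ s → x ≤ len t → ear t x ≡ cycle i →
                                  x ≡ 0 ⊎ x ≡ len t
  other-ear-meets-cycle-at-ends {x} {t} {i} t≢r t≢s x≤ eq with walk-on-ears (toℕ i)
  ... | u , z , u∈rs , on-u =
    ear-ends t x≤ (intDisj t u t≢u _ z (trans eq on-u))
    where
    t≢u : t ≢ u
    t≢u t≡u = [ t≢r ∘ trans t≡u , t≢s ∘ trans t≡u ]′ u∈rs

  ear-r-step⇒CycSucc : ∀ {i j} → k < len r → ear r k ≡ cycle i → ear r (suc k) ≡ cycle j →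
                       CycSucc L i j
  ear-r-step⇒CycSucc k< eᵢ eⱼ =
    walk-step⇒CycSucc (<-≤-trans k< (m≤m+n (len r) (len s)))
      (trans (walk-r (<⇒≤ k<)) eᵢ) (trans (walk-r k<) eⱼ)

  ear-s-step⇒CycSucc : ∀ {i j} → k < len s → ear s k ≡ cycle i → ear s (suc k) ≡ cycle j →
                       CycSucc L j i
  ear-s-step⇒CycSucc {k} k< eᵢ eⱼ =
    walk-step⇒CycSucc (∸-monoʳ-< z<s 1+k≤L)
      (trans (sym (ear-s≡walk k<)) eⱼ)
      (trans (cong walk (sym (m∸n≡1+[m∸1+n] 1+k≤L))) (trans (sym (ear-s≡walk (<⇒≤ k<))) eᵢ))
    where
    1+k≤L : suc k ≤ L
    1+k≤L = ≤-trans k< (m≤n+m (len s) (len r))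

  module _ (no-other-edge : ∀ u → u ≢ r → u ≢ s → len u ≢ 1) where

    ear-step⇒CycSucc : ∀ t {i j} → k < len t → ear t k ≡ cycle i → ear t (suc k) ≡ cycle j →
                       CycSucc L i j ⊎ CycSucc L j i
    ear-step⇒CycSucc t {i} {j} k< eᵢ eⱼ with t ≟ᶠ r | t ≟ᶠ s
    ... | yes refl | _ = inj₁ (ear-r-step⇒CycSucc k< eᵢ eⱼ)
    ... | no _ | yes refl = inj₂ (ear-s-step⇒CycSucc k< eᵢ eⱼ)
    ... | no t≢r | no t≢s = ⊥-elim (no-other-edge t t≢r t≢s (ends-consecutive⇒≡1 k<
      (other-ear-meets-cycle-at-ends {i = i} t≢r t≢s (<⇒≤ k<) eᵢ)
      (other-ear-meets-cycle-at-ends {i = j} t≢r t≢s k< eⱼ)))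

    chordless : ∀ i j → Adj G (cycle i) (cycle j) → CycConsec L i j
    chordless i j adj with walk-on-ears (toℕ i) | walk-on-ears (toℕ j)
    ... | u , x , _ , eᵢ | v , y , _ , eⱼ with induced u v x y (subst₂ (Adj G) eᵢ eⱼ adj)
    ... | t , m , inj₁ (e , e′) = CycSucc⊎⇒CycConsec
      (ear-step⇒CycSucc t (toℕ<n m) (trans (ear-inject₁ t m) (trans e (sym eᵢ)))
                                    (trans (ear-toℕ t (fsuc m)) (trans e′ (sym eⱼ))))
    ... | t , m , inj₂ (e , e′) = CycSucc⊎⇒CycConsec (swap
      (ear-step⇒CycSucc t (toℕ<n m) (trans (ear-inject₁ t m) (trans e (sym eⱼ)))
                                    (trans (ear-toℕ t (fsuc m)) (trans e′ (sym eᵢ)))))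

    isInducedCycle : IsInducedCycle G L cycle
    isInducedCycle = isCycle , chordless

module _ {ℓ n} {G : Graph n} (girth : HasGirth G (2 * ℓ)) (H : Theta G) where
  open Theta H

  girth≤ears : ∀ {r s} → r ≢ s → 2 * ℓ ≤ len r + len s
  girth≤ears r≢s = proj₂ girth _ _ (TwoEarCycle.isCycle H r≢s)

  even-ears≡girth : 2 ≤ ℓ → NoEvenHoleAtLeast G (2 * ℓ + 2) → ∀ {r s} → r ≢ s →
                    (∀ u → u ≢ r → u ≢ s → len u ≢ 1) →
                    Even (len r + len s) → len r + len s ≡ 2 * ℓ
  even-ears≡girth 2≤ℓ no-even-hole {r} {s} r≢s no-other-edge even with m≤n⇒m<n∨m≡n (girth≤ears r≢s)
  ... | inj₂ eq = sym eq
  ... | inj₁ lt = contradiction (even<even⇒+2≤ (m∣m*n ℓ) even lt) (no-even-hole _ _ hole even)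
    where
    hole : IsHole G (len r + len s) (TwoEarCycle.cycle H r≢s)
    hole = TwoEarCycle.isInducedCycle H r≢s no-other-edge ,
           ≤-trans (*-monoʳ-≤ 2 2≤ℓ) (girth≤ears r≢s)

  even-theta : 2 ≤ ℓ → NoEvenHoleAtLeast G (2 * ℓ + 2) →
               (∀ r s → r ≢ s → Even (len r + len s)) →
               (∀ r → len r ≡ ℓ) ⊎ ∃[ r ] (len r ≡ 1 × (∀ s → s ≢ r → len s ≢ 1))
  even-theta 2≤ℓ no-even-hole even with any? (λ r → len r ≟ 1)
  ... | yes (r , r-edge) = inj₂ (r , r-edge , λ s s≢r s-edge → distinct s r s≢r (s-edge , r-edge))
  ... | no no-edge = inj₁ all≡ℓ
    where
    sum≡2ℓ : ∀ r s → r ≢ s → len r + len s ≡ 2 * ℓ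
    sum≡2ℓ r s r≢s =
      even-ears≡girth 2≤ℓ no-even-hole r≢s (λ u _ _ u-edge → no-edge (u , u-edge)) (even r s r≢s)
    0₃ 1₃ 2₃ : Fin 3
    0₃ = fzero
    1₃ = fsuc fzero
    2₃ = fsuc (fsuc fzero)
    lengths≡ℓ : len 0₃ ≡ ℓ × len 1₃ ≡ ℓ × len 2₃ ≡ ℓ
    lengths≡ℓ = equal-pairwise-sums (sum≡2ℓ 0₃ 1₃ λ ()) (sum≡2ℓ 0₃ 2₃ λ ()) (sum≡2ℓ 1₃ 2₃ λ ())
    all≡ℓ : ∀ r → len r ≡ ℓ
    all≡ℓ fzero = proj₁ lengths≡ℓ
    all≡ℓ (fsuc fzero) = proj₁ (proj₂ lengths≡ℓ)
    all≡ℓ (fsuc (fsuc fzero)) = proj₂ (proj₂ lengths≡ℓ)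

  odd-theta : 2 ≤ ℓ → NoEvenHoleAtLeast G (2 * ℓ + 2) →
              ∀ q p p′ → q ≢ p → q ≢ p′ → p ≢ p′ →
              Odd (len q + len p) → Odd (len q + len p′) →
              len q ≡ 1 ⊎ ℓ ⊔ len p ⊔ len p′ < len q
  odd-theta 2≤ℓ no-even-hole q p p′ q≢p q≢p′ p≢p′ odd odd′ with len q ≟ 1
  ... | yes q-edge = inj₁ q-edge
  ... | no q-not-edge = inj₂ (ℓ⊔m⊔n<o p+p′≡2ℓ (above-girth q≢p odd) (above-girth q≢p′ odd′))
    where
    only-q : ∀ u → u ≢ p → u ≢ p′ → len u ≢ 1
    only-q u u≢p u≢p′ =
      subst (λ t → len t ≢ 1) (sym (Fin3-third p≢p′ (q≢p ∘ sym) (q≢p′ ∘ sym) u≢p u≢p′)) q-not-edge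
    p+p′≡2ℓ : len p + len p′ ≡ 2 * ℓ
    p+p′≡2ℓ = even-ears≡girth 2≤ℓ no-even-hole p≢p′ only-q (odd-sums⇒even {len q} odd odd′)
    above-girth : ∀ {t} → q ≢ t → Odd (len q + len t) → 2 * ℓ < len q + len t
    above-girth q≢t odd-qt = even≤odd⇒< (m∣m*n ℓ) odd-qt (girth≤ears q≢t)

lemma2p2 : (ℓ : ℕ) → 2 ≤ ℓ → {n : ℕ} (G : Graph n) →
    HasGirth G (2 * ℓ) → NoEvenHoleAtLeast G (2 * ℓ + 2) → (H : Theta G) →
    ((∀ r s → r ≢ s → Even (Theta.len H r + Theta.len H s)) →
       (∀ r → Theta.len H r ≡ ℓ)
       ⊎ (∃[ r ] (Theta.len H r ≡ 1 × (∀ s → s ≢ r → Theta.len H s ≢ 1))))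
    × (∀ q p p′ → q ≢ p → q ≢ p′ → p ≢ p′ →
       Odd (Theta.len H q + Theta.len H p) → Odd (Theta.len H q + Theta.len H p′) →
       Theta.len H q ≡ 1 ⊎ ℓ ⊔ Theta.len H p ⊔ Theta.len H p′ < Theta.len H q)
lemma2p2 ℓ 2≤ℓ G girth no-even-hole H =
  even-theta girth H 2≤ℓ no-even-hole , odd-theta girth H 2≤ℓ no-even-hole
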